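{- Let $q$ be a prime power, $e,d$ integers with $e>d>0$ and $g\in\mathbb{F}_q[T]$ monic of degree $e$. Let $k$ be the least degree of a monic irreducible factor of $g$ in $\mathbb{F}_q[T]$. Let $\mathcal{X}_g(f)=\deg\gcd(g,f)$ for $f$ uniformly distributed over the monic polynomials of degree $d$ in $\mathbb{F}_q[T]$. Then $$E[\mathcal{X}_g]\le\frac{de}{q^k}.$$
   Context: $E$ denotes expected value with respect to the uniform probability on the set of monic polynomials of degree $d$ in $\mathbb{F}_q[T]$. -}

module Defs where

open import Level using (Level; _⊔_) renaming (suc to lsuc)
open import Algebra.Bundles using (CommutativeRing)
open import Data.Nat as ℕ using (ℕ; zero; suc)
open import Data.Fin using (Fin)
open import Data.List as List using (List; []; _∷_; _++_; [_])
open import Data.Vec as Vec using (Vec; []; _∷_)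
open import Data.Product using (Σ; ∃; _×_; _,_)
open import Data.Sum using (_⊎_)
open import Relation.Nullary using (¬_)
open import Relation.Binary.PropositionalEquality using (_≡_)
open import Data.Nat.Primality using (Prime)
open import Data.Nat.ListAction using (sum)

record FiniteField (c ℓ : Level) (q : ℕ) : Set (lsuc (c ⊔ ℓ)) where
  field
    cring : CommutativeRing c ℓ
  open CommutativeRing cring public
  field
    0≉1     : ¬ (0# ≈ 1#)
    inverse : ∀ x → ¬ (x ≈ 0#) → ∃ λ y → x * y ≈ 1#
    enum    : Fin q → Carrier
    enum-injective  : ∀ i j → enum i ≈ enum j → i ≡ j
    enum-surjective : ∀ x → ∃ λ i → enum i ≈ x

module Poly {c ℓ : Level} {q : ℕ} (F : FiniteField c ℓ q) where
  open FiniteField F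

  -- a polynomial is a list of coefficients, constant term first
  Pol : Set c
  Pol = List Carrier

  coeff : Pol → ℕ → Carrier
  coeff []       _       = 0#
  coeff (a ∷ p)  zero    = a
  coeff (a ∷ p)  (suc i) = coeff p i

  _≈P_ : Pol → Pol → Set ℓ
  p ≈P r = ∀ i → coeff p i ≈ coeff r i

  0P : Pol
  0P = []

  1P : Pol
  1P = 1# ∷ []

  _+P_ : Pol → Pol → Pol
  []      +P r       = r
  (a ∷ p) +P []      = a ∷ p
  (a ∷ p) +P (b ∷ r) = (a + b) ∷ (p +P r)

  scale : Carrier → Pol → Pol
  scale a = List.map (a *_)

  _*P_ : Pol → Pol → Pol
  []      *P r = []
  (a ∷ p) *P r = scale a r +P (0# ∷ (p *P r))

  _∣P_ : Pol → Pol → Set (c ⊔ ℓ)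
  a ∣P b = ∃ λ (r : Pol) → (a *P r) ≈P b

  IsUnit : Pol → Set (c ⊔ ℓ)
  IsUnit a = ∃ λ (r : Pol) → (a *P r) ≈P 1P

  Irreducible : Pol → Set (c ⊔ ℓ)
  Irreducible p = (¬ (p ≈P 0P)) × (¬ IsUnit p)
                × (∀ a b → (a *P b) ≈P p → IsUnit a ⊎ IsUnit b)

  -- monic polynomials: degree n and the n lower coefficients;
  -- the leading coefficient (of T^n) is 1
  record Monic : Set c where
    constructor monic
    field
      deg : ℕ
      low : Vec Carrier deg

  open Monic public

  toPol : Monic → Pol
  toPol m = Vec.toList (low m) ++ [ 1# ]

  IsGCD : Pol → Pol → Monic → Set (c ⊔ ℓ)
  IsGCD a b h = (toPol h ∣P a) × (toPol h ∣P b)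
              × (∀ r → r ∣P a → r ∣P b → r ∣P toPol h)

  -- the monic polynomial of degree d coded by v : Vec (Fin q) d,
  -- via the enumeration of F; this is a bijection from Vec (Fin q) d
  -- onto the monic polynomials of degree d
  monicOf : ∀ {d} → Vec (Fin q) d → Monic
  monicOf {d} v = monic d (Vec.map enum v)

-- all vectors of length n over Fin q (q^n of them, each exactly once)
allVecs : (q n : ℕ) → List (Vec (Fin q) n)
allVecs q zero    = [ [] ]
allVecs q (suc n) =
  List.concatMap (λ i → List.map (i ∷_) (allVecs q n)) (List.allFin q)

sumVecs : (q n : ℕ) → (Vec (Fin q) n → ℕ) → ℕ
sumVecs q n f = sum (List.map f (allVecs q n))

IsPrimePower : ℕ → Set
IsPrimePower q = Σ ℕ λ p → Σ ℕ λ r → Prime p × (1 ℕ.≤ r) × (q ≡ p ℕ.^ r)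

-- Factor g = P₁ ⋯ P_r into monic irreducibles, so r ≤ deg g = e. If gcd(g, f) ≠ 1, an irreducible
-- factor of it is associate to some Pᵢ by Euclid's lemma, so Pᵢ ∣ f; hence deg gcd(g, f) ≤ d · #{i : Pᵢ ∣ f}.
-- Summing over the q^d monic f of degree d and exchanging the sums, it remains to see that each Pᵢ, of
-- degree m ≥ k, divides at most q^(d − m) ≤ q^(d − k) of them: two multiples of Pᵢ with the same d − m top
-- coefficients differ by a multiple of Pᵢ of degree < m, hence coincide.

module Submission where

open import Level using (Level; _⊔_)
open import Function using (_∘_; id; const)
open import Algebra.Bundles using (CommutativeRing)
open import Data.Empty using (⊥-elim)
open import Data.Fin as Fin using (Fin)
open import Data.Fin.Properties using (nonZeroIndex)
open import Data.List as List using (List; []; _∷_; _++_; [_]; allFin)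
import Data.List.Properties as List
open import Data.List.Membership.Propositional using (_∈_; lose)
open import Data.List.Membership.Propositional.Properties using (∈-allFin; ∈-map⁺; ∈-concatMap⁺)
open import Data.List.Relation.Unary.All as All using (All; []; _∷_)
open import Data.List.Relation.Unary.Any using (Any; here; there; any?; satisfied)
import Data.List.Relation.Unary.Any.Properties as AnyP
open import Data.Nat as ℕ using (ℕ; zero; suc; z≤n; s≤s)
import Data.Nat.Induction as ℕ
import Data.Nat.Properties as ℕ
open import Data.Product using (Σ; ∃; _×_; _,_; proj₁; proj₂)
open import Data.Sum using (_⊎_; inj₁; inj₂)
open import Data.Vec as Vec using (Vec; []; _∷_)
import Data.Vec.Properties as Vec
open import Induction.WellFounded using (Acc; acc)
open import Relation.Binary.Bundles using (Setoid)
open import Relation.Binary.Definitions using (tri<; tri≈; tri>)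
open import Relation.Binary.Structures using (IsEquivalence)
open import Relation.Binary.PropositionalEquality as ≡ using (_≡_)
import Relation.Binary.Reasoning.Setoid
open import Relation.Nullary using (¬_; Dec; yes; no)

open import Defs

module Counting where

  open import Data.Nat using (_+_; _*_; _^_; _≤_)
  open ≡ using (refl; cong; cong₂)
  open import Data.Nat.Properties using (≤-trans; ≤-reflexive; +-mono-≤; *-monoˡ-≤)
  open import Data.Nat.ListAction using (sum)
  import Data.Nat.ListAction.Properties as Sum
  open import Algebra.Properties.CommutativeSemigroup ℕ.+-commutativeSemigroup
    using () renaming (interchange to +-interchange)

  𝟙 : ∀ {p} {P : Set p} → Dec P → ℕ
  𝟙 (yes _) = 1
  𝟙 (no _)  = 0

  module _ {a} {A : Set a} where

    ∑ : List A → (A → ℕ) → ℕ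
    ∑ xs f = sum (List.map f xs)

    syntax ∑ xs (λ x → e) = ∑[ x ∈ xs ] e

    ∑-cong : ∀ xs {f g : A → ℕ} → (∀ x → f x ≡ g x) → ∑ xs f ≡ ∑ xs g
    ∑-cong []       f≗g = refl
    ∑-cong (x ∷ xs) f≗g = cong₂ _+_ (f≗g x) (∑-cong xs f≗g)

    ∑-mono-≤ : ∀ xs {f g : A → ℕ} → (∀ x → f x ≤ g x) → ∑ xs f ≤ ∑ xs g
    ∑-mono-≤ []       f≤g = z≤n
    ∑-mono-≤ (x ∷ xs) f≤g = +-mono-≤ (f≤g x) (∑-mono-≤ xs f≤g)

    ∑-const : ∀ xs c → ∑[ x ∈ xs ] c ≡ List.length xs * c
    ∑-const []       c = refl
    ∑-const (x ∷ xs) c = cong (c +_) (∑-const xs c)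

    ∑-zero : ∀ xs → ∑[ x ∈ xs ] 0 ≡ 0
    ∑-zero xs = ≡.trans (∑-const xs 0) (ℕ.*-zeroʳ (List.length xs))

    ∑-+ : ∀ xs (f g : A → ℕ) → ∑[ x ∈ xs ] (f x + g x) ≡ ∑ xs f + ∑ xs g
    ∑-+ []       f g = refl
    ∑-+ (x ∷ xs) f g = ≡.trans (cong (f x + g x +_) (∑-+ xs f g))
                               (+-interchange (f x) (g x) (∑ xs f) (∑ xs g))

    ∑-*ˡ : ∀ xs c (f : A → ℕ) → ∑[ x ∈ xs ] (c * f x) ≡ c * ∑ xs f
    ∑-*ˡ []       c f = ≡.sym (ℕ.*-zeroʳ c)
    ∑-*ˡ (x ∷ xs) c f = ≡.trans (cong (c * f x +_) (∑-*ˡ xs c f))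
                                (≡.sym (ℕ.*-distribˡ-+ c (f x) (∑ xs f)))

    ∑-++ : ∀ xs ys (f : A → ℕ) → ∑ (xs ++ ys) f ≡ ∑ xs f + ∑ ys f
    ∑-++ xs ys f = ≡.trans (cong sum (List.map-++ f xs ys))
                           (Sum.sum-++ (List.map f xs) (List.map f ys))

    ∑-*ʳ : ∀ xs c (f : A → ℕ) → ∑[ x ∈ xs ] (f x * c) ≡ ∑ xs f * c
    ∑-*ʳ []       c f = refl
    ∑-*ʳ (x ∷ xs) c f = ≡.trans (cong (f x * c +_) (∑-*ʳ xs c f))
                                (≡.sym (ℕ.*-distribʳ-+ c (f x) (∑ xs f)))

    ∑-bounded : ∀ {xs} {f : A → ℕ} {c} → All (λ x → f x ≤ c) xs →
                ∑ xs f ≤ List.length xs * c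
    ∑-bounded []           = z≤n
    ∑-bounded (fx≤c ∷ f≤c) = +-mono-≤ fx≤c (∑-bounded f≤c)

    ∑-𝟙-Any : ∀ {p} {P : A → Set p} (P? : ∀ x → Dec (P x)) {xs} →
              Any P xs → 1 ≤ ∑[ x ∈ xs ] 𝟙 (P? x)
    ∑-𝟙-Any P? {x ∷ xs} (here Px) with P? x
    ... | yes _  = s≤s z≤n
    ... | no ¬Px = ⊥-elim (¬Px Px)
    ∑-𝟙-Any P? {x ∷ xs} (there P∈xs) = ≤-trans (∑-𝟙-Any P? P∈xs) (ℕ.m≤n+m _ (𝟙 (P? x)))

  module _ {a b} {A : Set a} {B : Set b} where

    ∑-comm : ∀ xs (ys : List B) (h : A → B → ℕ) →
             ∑[ x ∈ xs ] ∑[ y ∈ ys ] h x y ≡ ∑[ y ∈ ys ] ∑[ x ∈ xs ] h x y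
    ∑-comm []       ys h = ≡.sym (∑-zero ys)
    ∑-comm (x ∷ xs) ys h = ≡.trans (cong (∑ ys (h x) +_) (∑-comm xs ys h))
                                   (≡.sym (∑-+ ys (h x) (λ y → ∑[ x ∈ xs ] h x y)))

    ∑-map : ∀ (g : A → B) xs (f : B → ℕ) → ∑ (List.map g xs) f ≡ ∑ xs (f ∘ g)
    ∑-map g xs f = cong sum (≡.sym (List.map-∘ xs))

    ∑-concatMap : ∀ (g : A → List B) xs (f : B → ℕ) →
                  ∑ (List.concatMap g xs) f ≡ ∑[ x ∈ xs ] ∑ (g x) f
    ∑-concatMap g []       f = refl
    ∑-concatMap g (x ∷ xs) f = ≡.trans (∑-++ (g x) (List.concatMap g xs) f)
                                       (cong (∑ (g x) f +_) (∑-concatMap g xs f))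

  δ : ∀ {m} → Fin m → Fin m → ℕ
  δ Fin.zero    Fin.zero    = 1
  δ Fin.zero    (Fin.suc _) = 0
  δ (Fin.suc _) Fin.zero    = 0
  δ (Fin.suc i) (Fin.suc j) = δ i j

  ∑-allFin-suc : ∀ m (f : Fin (suc m) → ℕ) →
                 ∑ (allFin (suc m)) f ≡ f Fin.zero + ∑[ i ∈ allFin m ] f (Fin.suc i)
  ∑-allFin-suc m f = cong (f Fin.zero +_) (cong sum
    (≡.trans (List.map-tabulate Fin.suc f) (≡.sym (List.map-tabulate id (f ∘ Fin.suc)))))

  ∑-allFin-δ : ∀ m (j : Fin m) → ∑[ i ∈ allFin m ] δ i j ≡ 1
  ∑-allFin-δ (suc m) Fin.zero    = ≡.trans (∑-allFin-suc m (λ i → δ i Fin.zero))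
    (cong suc (∑-zero (allFin m)))
  ∑-allFin-δ (suc m) (Fin.suc j) =
    ≡.trans (∑-allFin-suc m (λ i → δ i (Fin.suc j))) (∑-allFin-δ m j)

  δᵛ : ∀ {m n} → Vec (Fin m) n → Vec (Fin m) n → ℕ
  δᵛ []      []        = 1
  δᵛ (i ∷ v) (j ∷ w) = δ i j * δᵛ v w

  δᵛ-refl : ∀ {m n} (v : Vec (Fin m) n) → δᵛ v v ≡ 1
  δᵛ-refl []      = refl
  δᵛ-refl (i ∷ v) = cong₂ _*_ (δ-refl i) (δᵛ-refl v)
    where
    δ-refl : ∀ {m} (i : Fin m) → δ i i ≡ 1
    δ-refl Fin.zero    = refl
    δ-refl (Fin.suc i) = δ-refl i

  module _ {q : ℕ} where

    ∈-allVecs : ∀ {n} (w : Vec (Fin q) n) → w ∈ allVecs q n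
    ∈-allVecs []      = here refl
    ∈-allVecs {suc n} (i ∷ w) = ∈-concatMap⁺ (λ j → List.map (j ∷_) (allVecs q n))
                                  (lose (∈-allFin i) (∈-map⁺ (i ∷_) (∈-allVecs w)))

    ∑-allVecs-suc : ∀ n (h : Vec (Fin q) (suc n) → ℕ) →
      ∑ (allVecs q (suc n)) h ≡ ∑[ i ∈ allFin q ] ∑[ w ∈ allVecs q n ] h (i ∷ w)
    ∑-allVecs-suc n h = ≡.trans (∑-concatMap _ (allFin q) h)
                                (∑-cong (allFin q) (λ i → ∑-map (i ∷_) (allVecs q n) h))

    ∑-allVecs-++ : ∀ m n (h : Vec (Fin q) (m + n) → ℕ) →
      ∑ (allVecs q (m + n)) h ≡ ∑[ a ∈ allVecs q m ] ∑[ b ∈ allVecs q n ] h (a Vec.++ b)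
    ∑-allVecs-++ zero    n h = ≡.sym (ℕ.+-identityʳ _)
    ∑-allVecs-++ (suc m) n h = ≡.trans (∑-allVecs-suc (m + n) h) (≡.trans
      (∑-cong (allFin q) (λ i → ∑-allVecs-++ m n (h ∘ (i ∷_))))
      (≡.sym (∑-allVecs-suc m _)))

    ∑-allVecs-const : ∀ n c → ∑[ w ∈ allVecs q n ] c ≡ q ^ n * c
    ∑-allVecs-const zero    c = refl
    ∑-allVecs-const (suc n) c = begin
      ∑ (allVecs q (suc n)) (const c)                    ≡⟨ ∑-allVecs-suc n (const c) ⟩
      ∑[ i ∈ allFin q ] ∑[ w ∈ allVecs q n ] c           ≡⟨ ∑-const (allFin q) _ ⟩
      List.length (allFin q) * ∑[ w ∈ allVecs q n ] c    ≡⟨ cong₂ _*_ (List.length-tabulate {n = q} id)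
                                                                       (∑-allVecs-const n c) ⟩
      q * (q ^ n * c)                                    ≡⟨ ℕ.*-assoc q (q ^ n) c ⟨
      q ^ suc n * c                                      ∎
      where open ≡.≡-Reasoning


    ∑-allVecs-δᵛ : ∀ n (w₀ : Vec (Fin q) n) → ∑[ w ∈ allVecs q n ] δᵛ w w₀ ≡ 1
    ∑-allVecs-δᵛ zero    []        = refl
    ∑-allVecs-δᵛ (suc n) (j ∷ w₀) = begin
      ∑[ w ∈ allVecs q (suc n) ] δᵛ w (j ∷ w₀)          ≡⟨ ∑-allVecs-suc n _ ⟩
      ∑[ i ∈ allFin q ] ∑[ w ∈ allVecs q n ] (δ i j * δᵛ w w₀)
        ≡⟨ ∑-cong (allFin q) (λ i → ∑-*ˡ (allVecs q n) (δ i j) (λ w → δᵛ w w₀)) ⟩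
      ∑[ i ∈ allFin q ] (δ i j * ∑[ w ∈ allVecs q n ] δᵛ w w₀)
        ≡⟨ ∑-cong (allFin q) (λ i → cong (δ i j *_) (∑-allVecs-δᵛ n w₀)) ⟩
      ∑[ i ∈ allFin q ] (δ i j * 1)
        ≡⟨ ∑-cong (allFin q) (λ i → ℕ.*-identityʳ (δ i j)) ⟩
      ∑[ i ∈ allFin q ] δ i j                           ≡⟨ ∑-allFin-δ q j ⟩
      1                                                 ∎
      where open ≡.≡-Reasoning

    ∑-allVecs-𝟙-unique : ∀ n {p} {P : Vec (Fin q) n → Set p} (P? : ∀ w → Dec (P w)) →
      (∀ {w w′} → P w → P w′ → w ≡ w′) → ∑[ w ∈ allVecs q n ] 𝟙 (P? w) ≤ 1
    ∑-allVecs-𝟙-unique n P? unique with any? P? (allVecs q n)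
    ... | no ∄P =
      ≤-trans (∑-mono-≤ (allVecs q n) 𝟙≤0) (≤-trans (≤-reflexive (∑-zero (allVecs q n))) z≤n)
      where
      𝟙≤0 : ∀ w → 𝟙 (P? w) ≤ 0
      𝟙≤0 w with P? w
      ... | no _   = z≤n
      ... | yes Pw = ⊥-elim (∄P (lose (∈-allVecs w) Pw))
    ... | yes ∃P with satisfied ∃P
    ...   | w₀ , Pw₀ =
      ≤-trans (∑-mono-≤ (allVecs q n) 𝟙≤δᵛ) (≤-reflexive (∑-allVecs-δᵛ n w₀))
      where
      𝟙≤δᵛ : ∀ w → 𝟙 (P? w) ≤ δᵛ w w₀
      𝟙≤δᵛ w with P? w
      ... | no _   = z≤n
      ... | yes Pw = ≤-reflexive (≡.trans (≡.sym (δᵛ-refl w)) (cong (δᵛ w) (unique Pw Pw₀)))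

    ∑-allVecs-𝟙-prefix-unique : ∀ m n {p} {P : Vec (Fin q) (m + n) → Set p}
      (P? : ∀ w → Dec (P w)) →
      (∀ {a a′} b → P (a Vec.++ b) → P (a′ Vec.++ b) → a ≡ a′) →
      (∑[ w ∈ allVecs q (m + n) ] 𝟙 (P? w)) * q ^ m ≤ q ^ (m + n)
    ∑-allVecs-𝟙-prefix-unique m n P? unique = begin
      (∑[ w ∈ allVecs q (m + n) ] 𝟙 (P? w)) * q ^ m
        ≡⟨ cong (_* q ^ m) (≡.trans (∑-allVecs-++ m n _) (∑-comm (allVecs q m) (allVecs q n) _)) ⟩
      (∑[ b ∈ allVecs q n ] ∑[ a ∈ allVecs q m ] 𝟙 (P? (a Vec.++ b))) * q ^ m
        ≤⟨ *-monoˡ-≤ (q ^ m) (∑-mono-≤ (allVecs q n)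
             (λ b → ∑-allVecs-𝟙-unique m (λ a → P? (a Vec.++ b)) (unique b))) ⟩
      (∑[ b ∈ allVecs q n ] 1) * q ^ m
        ≡⟨ cong (_* q ^ m) (≡.trans (∑-allVecs-const n 1) (ℕ.*-identityʳ (q ^ n))) ⟩
      q ^ n * q ^ m  ≡⟨ ℕ.*-comm (q ^ n) (q ^ m) ⟩
      q ^ m * q ^ n  ≡⟨ ℕ.^-distribˡ-+-* q m n ⟨
      q ^ (m + n)    ∎
      where open ℕ.≤-Reasoning

open Counting

module PolyProperties {c ℓ : Level} {q : ℕ} (F : FiniteField c ℓ q) where

  open FiniteField F hiding (zero)
  open Poly F
  open import Algebra.Properties.Ring ring using (-1*x≈-x)
  open import Algebra.Properties.CommutativeSemigroup +-commutativeSemigroup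
    using (interchange; x∙yz≈y∙xz)
  module ≈-Reasoning = Relation.Binary.Reasoning.Setoid setoid

  enum⁻¹ : Carrier → Fin q
  enum⁻¹ x = proj₁ (enum-surjective x)

  enum∘enum⁻¹ : ∀ x → enum (enum⁻¹ x) ≈ x
  enum∘enum⁻¹ x = proj₂ (enum-surjective x)

  _≈?_ : (x y : Carrier) → Dec (x ≈ y)
  x ≈? y with enum⁻¹ x Fin.≟ enum⁻¹ y
  ... | yes i≡j = yes (trans (sym (enum∘enum⁻¹ x))
                      (trans (reflexive (≡.cong enum i≡j)) (enum∘enum⁻¹ y)))
  ... | no  i≢j = no λ x≈y → i≢j (enum-injective _ _
                    (trans (enum∘enum⁻¹ x) (trans x≈y (sym (enum∘enum⁻¹ y)))))

  1≉0 : 1# ≉ 0#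
  1≉0 1≈0 = 0≉1 (sym 1≈0)

  inv : ∀ x → x ≉ 0# → Carrier
  inv x x≉0 = proj₁ (inverse x x≉0)

  inv-inverseʳ : ∀ x (x≉0 : x ≉ 0#) → x * inv x x≉0 ≈ 1#
  inv-inverseʳ x x≉0 = proj₂ (inverse x x≉0)

  inv-inverseˡ : ∀ x (x≉0 : x ≉ 0#) → inv x x≉0 * x ≈ 1#
  inv-inverseˡ x x≉0 = trans (*-comm _ _) (inv-inverseʳ x x≉0)

  *-≉0 : ∀ {x y} → x ≉ 0# → y ≉ 0# → x * y ≉ 0#
  *-≉0 {x} {y} x≉0 y≉0 xy≈0 = y≉0 (begin
    y                    ≈⟨ *-identityˡ y ⟨
    1# * y               ≈⟨ *-congʳ (inv-inverseˡ x x≉0) ⟨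
    (inv x x≉0 * x) * y  ≈⟨ *-assoc _ _ _ ⟩
    inv x x≉0 * (x * y)  ≈⟨ *-congˡ xy≈0 ⟩
    inv x x≉0 * 0#       ≈⟨ zeroʳ _ ⟩
    0#                   ∎)
    where open ≈-Reasoning

  -- The polynomial ring F[T]

  -- Defs' _≈P_ is a bare Π-type, from which Agda cannot infer the polynomials it relates.
  record _≋_ (p r : Pol) : Set ℓ where
    constructor mk≋
    field coeff-≈ : ∀ i → coeff p i ≈ coeff r i
  open _≋_ public
  infix 4 _≋_

  ≋-isEquivalence : IsEquivalence _≋_
  ≋-isEquivalence = record
    { refl  = mk≋ λ i → refl
    ; sym   = λ p≋r → mk≋ λ i → sym (coeff-≈ p≋r i)
    ; trans = λ p≋r r≋s → mk≋ λ i → trans (coeff-≈ p≋r i) (coeff-≈ r≋s i)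
    }

  ≋-setoid : Setoid c ℓ
  ≋-setoid = record { isEquivalence = ≋-isEquivalence }

  open IsEquivalence ≋-isEquivalence public
    using () renaming (refl to ≋-refl; sym to ≋-sym; trans to ≋-trans)
  module ≋-Reasoning = Relation.Binary.Reasoning.Setoid ≋-setoid

  infix 25 T*_
  T*_ : Pol → Pol
  T* p = 0# ∷ p

  coeff-+P : ∀ p r i → coeff (p +P r) i ≈ coeff p i + coeff r i
  coeff-+P []      r       i       = sym (+-identityˡ _)
  coeff-+P (a ∷ p) []      i       = sym (+-identityʳ _)
  coeff-+P (a ∷ p) (b ∷ r) zero    = refl
  coeff-+P (a ∷ p) (b ∷ r) (suc i) = coeff-+P p r i

  coeff-scale : ∀ a p i → coeff (scale a p) i ≈ a * coeff p i
  coeff-scale a []      i       = sym (zeroʳ a)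
  coeff-scale a (b ∷ p) zero    = refl
  coeff-scale a (b ∷ p) (suc i) = coeff-scale a p i

  +P-cong : ∀ {p p′ r r′} → p ≋ p′ → r ≋ r′ → p +P r ≋ p′ +P r′
  +P-cong {p} {p′} {r} {r′} p≋p′ r≋r′ = mk≋ λ i →
    trans (coeff-+P p r i)
          (trans (+-cong (coeff-≈ p≋p′ i) (coeff-≈ r≋r′ i)) (sym (coeff-+P p′ r′ i)))

  +P-comm : ∀ p r → p +P r ≋ r +P p
  +P-comm p r = mk≋ λ i → trans (coeff-+P p r i) (trans (+-comm _ _) (sym (coeff-+P r p i)))

  +P-assoc : ∀ p r s → (p +P r) +P s ≋ p +P (r +P s)
  +P-assoc p r s = mk≋ λ i → begin
    coeff ((p +P r) +P s) i              ≈⟨ trans (coeff-+P (p +P r) s i) (+-congʳ (coeff-+P p r i)) ⟩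
    (coeff p i + coeff r i) + coeff s i  ≈⟨ +-assoc _ _ _ ⟩
    coeff p i + (coeff r i + coeff s i)  ≈⟨ trans (coeff-+P p (r +P s) i) (+-congˡ (coeff-+P r s i)) ⟨
    coeff (p +P (r +P s)) i              ∎
    where open ≈-Reasoning

  +P-identityʳ : ∀ p → p +P [] ≋ p
  +P-identityʳ p = mk≋ λ i → trans (coeff-+P p [] i) (+-identityʳ _)

  +P-interchange : ∀ p r s t → (p +P r) +P (s +P t) ≋ (p +P s) +P (r +P t)
  +P-interchange p r s t = mk≋ λ i → begin
    coeff ((p +P r) +P (s +P t)) i
      ≈⟨ trans (coeff-+P (p +P r) (s +P t) i) (+-cong (coeff-+P p r i) (coeff-+P s t i)) ⟩
    (coeff p i + coeff r i) + (coeff s i + coeff t i)  ≈⟨ interchange _ _ _ _ ⟩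
    (coeff p i + coeff s i) + (coeff r i + coeff t i)
      ≈⟨ trans (coeff-+P (p +P s) (r +P t) i) (+-cong (coeff-+P p s i) (coeff-+P r t i)) ⟨
    coeff ((p +P s) +P (r +P t)) i                      ∎
    where open ≈-Reasoning

  scale-cong : ∀ {a a′ p p′} → a ≈ a′ → p ≋ p′ → scale a p ≋ scale a′ p′
  scale-cong {a} {a′} {p} {p′} a≈a′ p≋p′ = mk≋ λ i →
    trans (coeff-scale a p i) (trans (*-cong a≈a′ (coeff-≈ p≋p′ i)) (sym (coeff-scale a′ p′ i)))

  scale-distribˡ : ∀ a p r → scale a (p +P r) ≋ (scale a p) +P (scale a r)
  scale-distribˡ a p r = mk≋ λ i → begin
    coeff (scale a (p +P r)) i       ≈⟨ trans (coeff-scale a (p +P r) i) (*-congˡ (coeff-+P p r i)) ⟩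
    a * (coeff p i + coeff r i)      ≈⟨ distribˡ _ _ _ ⟩
    a * coeff p i + a * coeff r i
      ≈⟨ trans (coeff-+P (scale a p) (scale a r) i) (+-cong (coeff-scale a p i) (coeff-scale a r i)) ⟨
    coeff ((scale a p) +P (scale a r)) i ∎
    where open ≈-Reasoning

  scale-distribʳ : ∀ a b p → scale (a + b) p ≋ (scale a p) +P (scale b p)
  scale-distribʳ a b p = mk≋ λ i → begin
    coeff (scale (a + b) p) i        ≈⟨ coeff-scale (a + b) p i ⟩
    (a + b) * coeff p i              ≈⟨ distribʳ _ _ _ ⟩
    a * coeff p i + b * coeff p i
      ≈⟨ trans (coeff-+P (scale a p) (scale b p) i) (+-cong (coeff-scale a p i) (coeff-scale b p i)) ⟨
    coeff ((scale a p) +P (scale b p)) i ∎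
    where open ≈-Reasoning

  scale-assoc : ∀ a b p → scale a (scale b p) ≋ scale (a * b) p
  scale-assoc a b p = mk≋ λ i → begin
    coeff (scale a (scale b p)) i  ≈⟨ trans (coeff-scale a (scale b p) i) (*-congˡ (coeff-scale b p i)) ⟩
    a * (b * coeff p i)            ≈⟨ *-assoc _ _ _ ⟨
    (a * b) * coeff p i            ≈⟨ coeff-scale (a * b) p i ⟨
    coeff (scale (a * b) p) i      ∎
    where open ≈-Reasoning

  scale-zeroˡ : ∀ p → scale 0# p ≋ []
  scale-zeroˡ p = mk≋ λ i → trans (coeff-scale 0# p i) (zeroˡ _)

  scale-identityˡ : ∀ p → scale 1# p ≋ p
  scale-identityˡ p = mk≋ λ i → trans (coeff-scale 1# p i) (*-identityˡ _)

  T*-cong : ∀ {p r} → p ≋ r → T* p ≋ T* r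
  T*-cong p≋r = mk≋ λ { zero → refl ; (suc i) → coeff-≈ p≋r i }

  T*-distrib-+P : ∀ p r → T* (p +P r) ≋ (T* p) +P (T* r)
  T*-distrib-+P p r = mk≋ λ { zero → sym (+-identityʳ 0#) ; (suc i) → refl }

  T*-[] : T* [] ≋ []
  T*-[] = mk≋ λ { zero → refl ; (suc i) → refl }

  scale-T* : ∀ a p → scale a (T* p) ≋ T* scale a p
  scale-T* a p = mk≋ λ { zero → zeroʳ a ; (suc i) → refl }

  ≋[]-tail : ∀ {a p} → a ∷ p ≋ [] → p ≋ []
  ≋[]-tail a∷p≋0 = mk≋ λ i → coeff-≈ a∷p≋0 (suc i)

  *P-zeroˡ : ∀ {p} r → p ≋ [] → p *P r ≋ []
  *P-zeroˡ {[]}    r p≋0 = ≋-refl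
  *P-zeroˡ {a ∷ p} r p≋0 = ≋-trans
    (+P-cong (scale-cong (coeff-≈ p≋0 zero) ≋-refl) (T*-cong (*P-zeroˡ r (≋[]-tail p≋0))))
    (≋-trans (+P-cong (scale-zeroˡ r) T*-[]) (+P-identityʳ []))

  *P-zeroʳ : ∀ p → p *P [] ≋ []
  *P-zeroʳ []      = ≋-refl
  *P-zeroʳ (a ∷ p) = ≋-trans (T*-cong (*P-zeroʳ p)) T*-[]

  *P-congˡ : ∀ {p p′} r → p ≋ p′ → p *P r ≋ p′ *P r
  *P-congˡ {[]}    {p′}     r p≋p′ = ≋-sym (*P-zeroˡ r (≋-sym p≋p′))
  *P-congˡ {a ∷ p} {[]}     r p≋p′ = *P-zeroˡ r p≋p′
  *P-congˡ {a ∷ p} {b ∷ p′} r p≋p′ =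
    +P-cong (scale-cong (coeff-≈ p≋p′ zero) ≋-refl)
            (T*-cong (*P-congˡ {p} {p′} r (mk≋ λ i → coeff-≈ p≋p′ (suc i))))

  *P-congʳ : ∀ p {r r′} → r ≋ r′ → p *P r ≋ p *P r′
  *P-congʳ []      r≋r′ = ≋-refl
  *P-congʳ (a ∷ p) r≋r′ = +P-cong (scale-cong refl r≋r′) (T*-cong (*P-congʳ p r≋r′))

  *P-cong : ∀ {p p′ r r′} → p ≋ p′ → r ≋ r′ → p *P r ≋ p′ *P r′
  *P-cong {p} {p′} {r} p≋p′ r≋r′ = ≋-trans (*P-congˡ r p≋p′) (*P-congʳ p′ r≋r′)

  *P-distribʳ : ∀ r p p′ → (p +P p′) *P r ≋ (p *P r) +P (p′ *P r)
  *P-distribʳ r []      p′       = ≋-refl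
  *P-distribʳ r (a ∷ p) []       = ≋-sym (+P-identityʳ _)
  *P-distribʳ r (a ∷ p) (b ∷ p′) = ≋-trans
    (+P-cong (scale-distribʳ a b r)
             (≋-trans (T*-cong (*P-distribʳ r p p′)) (T*-distrib-+P (p *P r) (p′ *P r))))
    (+P-interchange (scale a r) (scale b r) (T* (p *P r)) (T* (p′ *P r)))

  *P-distribˡ : ∀ p r s → p *P (r +P s) ≋ (p *P r) +P (p *P s)
  *P-distribˡ []      r s = ≋-refl
  *P-distribˡ (a ∷ p) r s = ≋-trans
    (+P-cong (scale-distribˡ a r s)
             (≋-trans (T*-cong (*P-distribˡ p r s)) (T*-distrib-+P (p *P r) (p *P s))))
    (+P-interchange (scale a r) (scale a s) (T* (p *P r)) (T* (p *P s)))

  scale-*Pˡ : ∀ a p r → scale a (p *P r) ≋ (scale a p) *P r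
  scale-*Pˡ a []      r = ≋-refl
  scale-*Pˡ a (b ∷ p) r = ≋-trans (scale-distribˡ a (scale b r) (T* (p *P r)))
    (+P-cong (scale-assoc a b r) (≋-trans (scale-T* a (p *P r)) (T*-cong (scale-*Pˡ a p r))))

  T*-*Pˡ : ∀ p r → (T* p) *P r ≋ T* (p *P r)
  T*-*Pˡ p r = ≋-trans (+P-cong (scale-zeroˡ r) ≋-refl) ≋-refl

  *P-∷ʳ : ∀ r a p → r *P (a ∷ p) ≋ scale a r +P (T* (r *P p))
  *P-∷ʳ []      a p = ≋-sym (≋-trans (+P-cong ≋-refl T*-[]) (+P-identityʳ []))
  *P-∷ʳ (b ∷ r) a p = mk≋ coeffs
    where
    open ≈-Reasoning
    coeffs : ∀ i → coeff ((b ∷ r) *P (a ∷ p)) i ≈ coeff (scale a (b ∷ r) +P (T* ((b ∷ r) *P p))) i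
    coeffs zero    = +-congʳ (*-comm b a)
    coeffs (suc i) = begin
      coeff ((b ∷ r) *P (a ∷ p)) (suc i)
        ≈⟨ coeff-+P (scale b (a ∷ p)) (T* (r *P (a ∷ p))) (suc i) ⟩
      coeff (scale b p) i + coeff (r *P (a ∷ p)) i
        ≈⟨ +-congˡ (trans (coeff-≈ (*P-∷ʳ r a p) i) (coeff-+P (scale a r) (T* (r *P p)) i)) ⟩
      coeff (scale b p) i + (coeff (scale a r) i + coeff (T* (r *P p)) i)
        ≈⟨ x∙yz≈y∙xz _ _ _ ⟩
      coeff (scale a r) i + (coeff (scale b p) i + coeff (T* (r *P p)) i)
        ≈⟨ +-congˡ (coeff-+P (scale b p) (T* (r *P p)) i) ⟨
      coeff (scale a r) i + coeff ((b ∷ r) *P p) i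
        ≈⟨ coeff-+P (scale a (b ∷ r)) (T* ((b ∷ r) *P p)) (suc i) ⟨
      coeff (scale a (b ∷ r) +P (T* ((b ∷ r) *P p))) (suc i) ∎

  *P-comm : ∀ p r → p *P r ≋ r *P p
  *P-comm []      r = ≋-sym (*P-zeroʳ r)
  *P-comm (a ∷ p) r = ≋-trans (+P-cong ≋-refl (T*-cong (*P-comm p r))) (≋-sym (*P-∷ʳ r a p))

  *P-assoc : ∀ p r s → (p *P r) *P s ≋ p *P (r *P s)
  *P-assoc []      r s = ≋-refl
  *P-assoc (a ∷ p) r s = ≋-trans (*P-distribʳ s (scale a r) (T* (p *P r)))
    (+P-cong (≋-sym (scale-*Pˡ a r s)) (≋-trans (T*-*Pˡ (p *P r) s) (T*-cong (*P-assoc p r s))))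

  *P-identityˡ : ∀ p → 1P *P p ≋ p
  *P-identityˡ p = ≋-trans (+P-cong (scale-identityˡ p) T*-[]) (+P-identityʳ p)

  *P-identityʳ : ∀ p → p *P 1P ≋ p
  *P-identityʳ p = ≋-trans (*P-comm p 1P) (*P-identityˡ p)

  [a]*P≋scale : ∀ {a p} r → p ≋ [] → (a ∷ p) *P r ≋ scale a r
  [a]*P≋scale {a} {p} r p≋0 =
    ≋-trans (+P-cong ≋-refl (≋-trans (T*-cong (*P-zeroˡ r p≋0)) T*-[])) (+P-identityʳ (scale a r))

  coeff-∷*P-suc : ∀ a p r i → coeff ((a ∷ p) *P r) (suc i) ≈ a * coeff r (suc i) + coeff (p *P r) i
  coeff-∷*P-suc a p r i =
    trans (coeff-+P (scale a r) (T* (p *P r)) (suc i)) (+-congʳ (coeff-scale a r (suc i)))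

  -P_ : Pol → Pol
  -P p = scale (- 1#) p

  coeff-P : ∀ p i → coeff (-P p) i ≈ - coeff p i
  coeff-P p i = trans (coeff-scale (- 1#) p i) (-1*x≈-x _)

  -P-inverseˡ : ∀ p → (-P p) +P p ≋ []
  -P-inverseˡ p = mk≋ λ i → trans (coeff-+P (-P p) p i) (trans (+-congʳ (coeff-P p i)) (-‿inverseˡ _))

  -P-inverseʳ : ∀ p → p +P (-P p) ≋ []
  -P-inverseʳ p = ≋-trans (+P-comm p (-P p)) (-P-inverseˡ p)

  ≋+P[] : ∀ {x y r} → x ≋ y +P r → r ≋ [] → x ≋ y
  ≋+P[] {y = y} x≋y+r r≋0 = ≋-trans x≋y+r (≋-trans (+P-cong ≋-refl r≋0) (+P-identityʳ y))

  F[T] : CommutativeRing c ℓ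
  F[T] = record
    { Carrier = Pol ; _≈_ = _≋_ ; _+_ = _+P_ ; _*_ = _*P_ ; -_ = -P_ ; 0# = [] ; 1# = 1P
    ; isCommutativeRing = record
      { isRing = record
        { +-isAbelianGroup = record
          { isGroup = record
            { isMonoid = record
              { isSemigroup = record
                { isMagma = record { isEquivalence = ≋-isEquivalence ; ∙-cong = +P-cong }
                ; assoc   = +P-assoc }
              ; identity = (λ p → ≋-refl) , +P-identityʳ }
            ; inverse = -P-inverseˡ , -P-inverseʳ
            ; ⁻¹-cong = scale-cong refl }
          ; comm = +P-comm }
        ; *-cong     = *P-cong
        ; *-assoc    = *P-assoc
        ; *-identity = *P-identityˡ , *P-identityʳ
        ; distrib    = (λ p r s → *P-distribˡ p r s) , *P-distribʳ }
      ; *-comm = *P-comm } }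

  open import Algebra.Properties.Semiring.Divisibility (CommutativeRing.semiring F[T]) public
    using (_∣_; _,_; 0∣x⇒x≈0; ∣ʳ-refl; ∣ʳ-trans; ∣ʳ-respʳ-≈; ∣ʳ-respˡ-≈;
           x∣ʳy⇒x∣ʳzy)
  open import Algebra.Properties.CommutativeSemigroup.Divisibility
    (CommutativeRing.*-commutativeSemigroup F[T]) using (x∣xy; xy≈z⇒x∣z)
  open import Algebra.Properties.AbelianGroup (CommutativeRing.+-abelianGroup F[T])
    using (xyx⁻¹≈y; x∙y⁻¹≈ε⇒x≈y)

  ∣P⇒∣ : ∀ {a b} → a ∣P b → a ∣ b
  ∣P⇒∣ {a} (r , ar≈b) = r , ≋-trans (*P-comm r a) (mk≋ ar≈b)

  ∣⇒∣P : ∀ {a b} → a ∣ b → a ∣P b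
  ∣⇒∣P {a} (r , ra≋b) = r , coeff-≈ (≋-trans (*P-comm a r) ra≋b)

  ∣-+P : ∀ {a b b′} → a ∣ b → a ∣ b′ → a ∣ b +P b′
  ∣-+P {a} (r , ra≋b) (r′ , r′a≋b′) =
    r +P r′ , ≋-trans (*P-distribʳ a r r′) (+P-cong ra≋b r′a≋b′)

  ∣-scale : ∀ {a b} x → a ∣ b → a ∣ scale x b
  ∣-scale {b = b} x a∣b = ∣ʳ-respʳ-≈ ([a]*P≋scale b ≋-refl) (x∣ʳy⇒x∣ʳzy [ x ] a∣b)

  ∣-+P-cancelˡ : ∀ {a b b′} → a ∣ b → a ∣ b +P b′ → a ∣ b′
  ∣-+P-cancelˡ {b = b} {b′} a∣b a∣b+b′ =
    ∣ʳ-respʳ-≈ (xyx⁻¹≈y b b′) (∣-+P a∣b+b′ (∣-scale (- 1#) a∣b))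

  -- Degrees

  record DegBelow (n : ℕ) (p : Pol) : Set ℓ where
    constructor degBelow
    field vanish : ∀ i → n ℕ.≤ i → coeff p i ≈ 0#
  open DegBelow public

  HasDegree : Pol → ℕ → Set ℓ
  HasDegree p n = DegBelow (suc n) p × coeff p n ≉ 0#

  IsMonic : Pol → ℕ → Set ℓ
  IsMonic p n = DegBelow (suc n) p × coeff p n ≈ 1#

  IsMonic⇒HasDegree : ∀ {p n} → IsMonic p n → HasDegree p n
  IsMonic⇒HasDegree (p<n+1 , lead≈1) = p<n+1 , λ lead≈0 → 1≉0 (trans (sym lead≈1) lead≈0)

  DegBelow-resp-≋ : ∀ {n p r} → p ≋ r → DegBelow n p → DegBelow n r
  DegBelow-resp-≋ p≋r p<n = degBelow λ i n≤i → trans (sym (coeff-≈ p≋r i)) (vanish p<n i n≤i)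

  HasDegree-resp-≋ : ∀ {n p r} → p ≋ r → HasDegree p n → HasDegree r n
  HasDegree-resp-≋ p≋r (p<n+1 , lead≉0) =
    DegBelow-resp-≋ p≋r p<n+1 , λ lead≈0 → lead≉0 (trans (coeff-≈ p≋r _) lead≈0)

  DegBelow-mono : ∀ {m n p} → m ℕ.≤ n → DegBelow m p → DegBelow n p
  DegBelow-mono m≤n p<m = degBelow λ i n≤i → vanish p<m i (ℕ.≤-trans m≤n n≤i)

  DegBelow-[] : ∀ {n} → DegBelow n []
  DegBelow-[] = degBelow λ i _ → refl

  DegBelow-0⇒≋[] : ∀ {p} → DegBelow 0 p → p ≋ []
  DegBelow-0⇒≋[] p<0 = mk≋ λ i → vanish p<0 i z≤n

  DegBelow-∷ : ∀ {n a p} → DegBelow n p → DegBelow (suc n) (a ∷ p)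
  DegBelow-∷ p<n = degBelow λ { zero () ; (suc i) (s≤s n≤i) → vanish p<n i n≤i }

  DegBelow-tail : ∀ {n a p} → DegBelow (suc n) (a ∷ p) → DegBelow n p
  DegBelow-tail a∷p<n+1 = degBelow λ i n≤i → vanish a∷p<n+1 (suc i) (s≤s n≤i)

  DegBelow-scale : ∀ {n p} a → DegBelow n p → DegBelow n (scale a p)
  DegBelow-scale {p = p} a p<n = degBelow λ i n≤i →
    trans (coeff-scale a p i) (trans (*-congˡ (vanish p<n i n≤i)) (zeroʳ a))

  HasDegree⇒≉[] : ∀ {p n} → HasDegree p n → ¬ p ≋ []
  HasDegree⇒≉[] (_ , lead≉0) p≋0 = lead≉0 (coeff-≈ p≋0 _)

  HasDegree-unique : ∀ {p m n} → HasDegree p m → HasDegree p n → m ≡ n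
  HasDegree-unique {m = m} {n} (p<m+1 , m≉0) (p<n+1 , n≉0) with ℕ.<-cmp m n
  ... | tri< m<n _ _ = ⊥-elim (n≉0 (vanish p<m+1 n m<n))
  ... | tri≈ _ m≡n _ = m≡n
  ... | tri> _ _ n<m = ⊥-elim (m≉0 (vanish p<n+1 m n<m))

  HasDegree∧DegBelow⇒< : ∀ {p m n} → HasDegree p m → DegBelow n p → m ℕ.< n
  HasDegree∧DegBelow⇒< {m = m} {n} (_ , lead≉0) p<n with m ℕ.<? n
  ... | yes m<n = m<n
  ... | no  m≮n = ⊥-elim (lead≉0 (vanish p<n m (ℕ.≮⇒≥ m≮n)))

  ≋[]⊎HasDegree : ∀ p → p ≋ [] ⊎ ∃ (HasDegree p)
  ≋[]⊎HasDegree []      = inj₁ ≋-refl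
  ≋[]⊎HasDegree (a ∷ p) with ≋[]⊎HasDegree p | a ≈? 0#
  ... | inj₂ (n , p<n+1 , lead≉0) | _      = inj₂ (suc n , DegBelow-∷ p<n+1 , lead≉0)
  ... | inj₁ p≋0 | yes a≈0 = inj₁ (mk≋ λ { zero → a≈0 ; (suc i) → coeff-≈ p≋0 i })
  ... | inj₁ p≋0 | no a≉0  = inj₂ (0 , DegBelow-∷ (degBelow λ i _ → coeff-≈ p≋0 i) , a≉0)

  normalise : ∀ {p n} → (p-deg : HasDegree p n) → IsMonic (scale (inv (coeff p n) (proj₂ p-deg)) p) n
  normalise {p} {n} (p<n+1 , lead≉0) =
    DegBelow-scale _ p<n+1 , trans (coeff-scale _ p n) (inv-inverseˡ _ lead≉0)

  normalise-∣ : ∀ {p n} (p-deg : HasDegree p n) → scale (inv (coeff p n) (proj₂ p-deg)) p ∣ p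
  normalise-∣ {p} {n} (_ , lead≉0) = ∣ʳ-respʳ-≈ lead·p′≋p (∣-scale lead ∣ʳ-refl)
    where
    lead = coeff p n
    lead·p′≋p : scale lead (scale (inv lead lead≉0) p) ≋ p
    lead·p′≋p = ≋-trans (scale-assoc lead _ p)
                (≋-trans (scale-cong (inv-inverseʳ lead lead≉0) ≋-refl) (scale-identityˡ p))

  DegBelow-*P : ∀ {m n} p r → DegBelow (suc m) p → DegBelow (suc n) r →
                DegBelow (suc (m ℕ.+ n)) (p *P r)
  DegBelow-*P          []      r p<m+1 r<n+1 = DegBelow-[]
  DegBelow-*P {zero}   (a ∷ p) r p<m+1 r<n+1 =
    DegBelow-resp-≋ (≋-sym ([a]*P≋scale r (DegBelow-0⇒≋[] (DegBelow-tail p<m+1))))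
                    (DegBelow-scale a r<n+1)
  DegBelow-*P {suc m} {n} (a ∷ p) r p<m+1 r<n+1 = degBelow λ where
    zero    ()
    (suc i) (s≤s m+n<i) → trans (coeff-∷*P-suc a p r i) (trans
      (+-cong (trans (*-congˡ (vanish r<n+1 (suc i) (s≤s (ℕ.≤-trans (ℕ.m≤n+m n (suc m)) m+n<i))))
                     (zeroʳ a))
              (vanish (DegBelow-*P p r (DegBelow-tail p<m+1) r<n+1) i m+n<i))
      (+-identityˡ 0#))

  coeff-*P-top : ∀ {m n} p r → DegBelow (suc m) p → DegBelow (suc n) r →
                 coeff (p *P r) (m ℕ.+ n) ≈ coeff p m * coeff r n
  coeff-*P-top          []      r p<m+1 r<n+1 = sym (zeroˡ _)
  coeff-*P-top {zero}   (a ∷ p) r p<m+1 r<n+1 =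
    trans (coeff-≈ ([a]*P≋scale r (DegBelow-0⇒≋[] (DegBelow-tail p<m+1))) _) (coeff-scale a r _)
  coeff-*P-top {suc m} {n} (a ∷ p) r p<m+1 r<n+1 = trans (coeff-∷*P-suc a p r (m ℕ.+ n)) (trans
    (+-cong (trans (*-congˡ (vanish r<n+1 (suc (m ℕ.+ n)) (s≤s (ℕ.m≤n+m n m)))) (zeroʳ a))
            (coeff-*P-top p r (DegBelow-tail p<m+1) r<n+1))
    (+-identityˡ _))

  HasDegree-*P : ∀ {p m r n} → HasDegree p m → HasDegree r n → HasDegree (p *P r) (m ℕ.+ n)
  HasDegree-*P {p} {m} {r} {n} (p<m+1 , p≉0) (r<n+1 , r≉0) =
    DegBelow-*P p r p<m+1 r<n+1 ,
    λ top≈0 → *-≉0 p≉0 r≉0 (trans (sym (coeff-*P-top p r p<m+1 r<n+1)) top≈0)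

  IsMonic-*P-cancelʳ : ∀ {a m b n} → HasDegree a m → IsMonic b n →
                       IsMonic (a *P b) (m ℕ.+ n) → IsMonic a m
  IsMonic-*P-cancelʳ {a} {m} {b} {n} (a<m+1 , _) (b<n+1 , b≈1) (_ , ab≈1) = a<m+1 , (begin
    coeff a m                ≈⟨ *-identityʳ _ ⟨
    coeff a m * 1#           ≈⟨ *-congˡ b≈1 ⟨
    coeff a m * coeff b n    ≈⟨ coeff-*P-top a b a<m+1 b<n+1 ⟨
    coeff (a *P b) (m ℕ.+ n) ≈⟨ ab≈1 ⟩
    1#                       ∎)
    where open ≈-Reasoning

  1P-isMonic : IsMonic 1P 0
  1P-isMonic = DegBelow-∷ DegBelow-[] , refl

  ∣⇒≋[]⊎HasDegree-+ : ∀ {a b m} → HasDegree a m → a ∣ b →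
                      b ≋ [] ⊎ ∃ λ n → HasDegree b (n ℕ.+ m)
  ∣⇒≋[]⊎HasDegree-+ {a} a-deg (r , ra≋b) with ≋[]⊎HasDegree r
  ... | inj₁ r≋0         = inj₁ (≋-trans (≋-sym ra≋b) (*P-zeroˡ a r≋0))
  ... | inj₂ (n , r-deg) = inj₂ (n , HasDegree-resp-≋ ra≋b (HasDegree-*P r-deg a-deg))

  ∣⇒deg≤ : ∀ {a b m n} → HasDegree a m → HasDegree b n → a ∣ b → m ℕ.≤ n
  ∣⇒deg≤ {m = m} a-deg b-deg a∣b with ∣⇒≋[]⊎HasDegree-+ a-deg a∣b
  ... | inj₁ b≋0          = ⊥-elim (HasDegree⇒≉[] b-deg b≋0)
  ... | inj₂ (k , b-deg′) = ≡.subst (m ℕ.≤_) (HasDegree-unique b-deg′ b-deg) (ℕ.m≤n+m m k)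

  ∣∧DegBelow⇒≋[] : ∀ {a b m} → HasDegree a m → a ∣ b → DegBelow m b → b ≋ []
  ∣∧DegBelow⇒≋[] {m = m} a-deg a∣b b<m with ∣⇒≋[]⊎HasDegree-+ a-deg a∣b
  ... | inj₁ b≋0        = b≋0
  ... | inj₂ (k , b-deg) = ⊥-elim (proj₂ b-deg (vanish b<m (k ℕ.+ m) (ℕ.m≤n+m m k)))

  1P≉[] : ¬ 1P ≋ []
  1P≉[] 1≋0 = 1≉0 (coeff-≈ 1≋0 zero)

  ∣1P⇒HasDegree0 : ∀ {u} → u ∣ 1P → HasDegree u 0
  ∣1P⇒HasDegree0 {u} u∣1 with ≋[]⊎HasDegree u
  ... | inj₁ u≋0         = ⊥-elim (1P≉[] (0∣x⇒x≈0 (∣ʳ-respˡ-≈ u≋0 u∣1)))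
  ... | inj₂ (n , u-deg) =
    ≡.subst (HasDegree u) (ℕ.n≤0⇒n≡0 (∣⇒deg≤ u-deg (IsMonic⇒HasDegree 1P-isMonic) u∣1))
            u-deg

  HasDegree0⇒∣1P : ∀ {u} → HasDegree u 0 → u ∣ 1P
  HasDegree0⇒∣1P {u} (u<1 , u₀≉0) = [ inv _ u₀≉0 ] , mk≋ λ where
      zero    → trans (coeff-≈ ([a]*P≋scale u ≋-refl) zero)
                  (trans (coeff-scale _ u zero) (inv-inverseˡ _ u₀≉0))
      (suc i) → trans (coeff-≈ ([a]*P≋scale u ≋-refl) (suc i))
                  (trans (coeff-scale _ u (suc i))
                         (trans (*-congˡ (vanish u<1 (suc i) (s≤s z≤n))) (zeroʳ _)))

  IsMonic-quotient : ∀ {a m b n Q} → IsMonic a m → IsMonic b n → Q *P a ≋ b →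
                     ∃ λ k → IsMonic Q k × k ℕ.+ m ≡ n
  IsMonic-quotient {a} {m} {b} {n} {Q} a-monic b-monic Qa≋b with ≋[]⊎HasDegree Q
  ... | inj₁ Q≋0 =
    ⊥-elim (HasDegree⇒≉[] (IsMonic⇒HasDegree b-monic) (≋-trans (≋-sym Qa≋b) (*P-zeroˡ a Q≋0)))
  ... | inj₂ (k , Q-deg) =
    k , IsMonic-*P-cancelʳ Q-deg a-monic (≡.subst (IsMonic (Q *P a)) (≡.sym k+m≡n) Qa-monic) , k+m≡n
    where
    Qa-monic : IsMonic (Q *P a) n
    Qa-monic = DegBelow-resp-≋ (≋-sym Qa≋b) (proj₁ b-monic) ,
               trans (coeff-≈ Qa≋b n) (proj₂ b-monic)
    k+m≡n : k ℕ.+ m ≡ n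
    k+m≡n = HasDegree-unique (HasDegree-*P Q-deg (IsMonic⇒HasDegree a-monic))
                             (HasDegree-resp-≋ (≋-sym Qa≋b) (IsMonic⇒HasDegree b-monic))

  toPol-isMonic : ∀ M → IsMonic (toPol M) (deg M)
  toPol-isMonic (monic n v) = isMonic v
    where
    isMonic : ∀ {n} (v : Vec Carrier n) → IsMonic (Vec.toList v List.++ [ 1# ]) n
    isMonic []      = 1P-isMonic
    isMonic (x ∷ v) = DegBelow-∷ (proj₁ (isMonic v)) , proj₂ (isMonic v)

  toPol-hasDegree : ∀ M → HasDegree (toPol M) (deg M)
  toPol-hasDegree M = IsMonic⇒HasDegree (toPol-isMonic M)

  tailP : Pol → Pol
  tailP []      = []
  tailP (_ ∷ p) = p

  coeff-tailP : ∀ p i → coeff (tailP p) i ≈ coeff p (suc i)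
  coeff-tailP []      i = refl
  coeff-tailP (a ∷ p) i = refl

  IsMonic-tailP : ∀ {p n} → IsMonic p (suc n) → IsMonic (tailP p) n
  IsMonic-tailP {p} (p<n+2 , lead≈1) =
    degBelow (λ i n<i → trans (coeff-tailP p i) (vanish p<n+2 (suc i) (s≤s n<i))) ,
    trans (coeff-tailP p _) lead≈1

  encode : ∀ {p} k → IsMonic p k → Σ (Vec (Fin q) k) λ w → toPol (monicOf w) ≋ p
  encode {p} zero    (p<1 , p₀≈1) = [] , mk≋ λ where
    zero    → sym p₀≈1
    (suc i) → sym (vanish p<1 (suc i) (s≤s z≤n))
  encode {p} (suc k) p-monic = enum⁻¹ (coeff p 0) ∷ proj₁ rest , mk≋ λ where
      zero    → enum∘enum⁻¹ (coeff p 0)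
      (suc i) → trans (coeff-≈ (proj₂ rest) i) (coeff-tailP p i)
    where rest = encode k (IsMonic-tailP p-monic)

  monicOf-injective : ∀ {n} {v v′ : Vec (Fin q) n} →
                      toPol (monicOf v) ≋ toPol (monicOf v′) → v ≡ v′
  monicOf-injective {v = []}    {[]}      _     = ≡.refl
  monicOf-injective {v = x ∷ v} {x′ ∷ v′} v≋v′ =
    ≡.cong₂ _∷_ (enum-injective x x′ (coeff-≈ v≋v′ zero))
                (monicOf-injective (mk≋ λ i → coeff-≈ v≋v′ (suc i)))

  coeff-monicOf-++ : ∀ {m n} (a : Vec (Fin q) m) (b : Vec (Fin q) n) j →
                     coeff (toPol (monicOf (a Vec.++ b))) (m ℕ.+ j) ≡ coeff (toPol (monicOf b)) j
  coeff-monicOf-++ []      b j = ≡.refl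
  coeff-monicOf-++ (x ∷ a) b j = coeff-monicOf-++ a b j

  -- Division by monic polynomials

  record Division (a b : Pol) (m : ℕ) : Set (c ⊔ ℓ) where
    constructor division
    field
      quotient    : Pol
      remainder   : Pol
      remainder<m : DegBelow m remainder
      b≋aq+r      : b ≋ (a *P quotient) +P remainder

  module _ {a m} (a-monic : IsMonic a m) where

    -- From b = a·Q + r we get x ∷ b = a·(T·Q) + (x ∷ r), where x ∷ r may reach degree m;
    -- moving lead · a from the remainder to the quotient brings it back below m.
    divide : ∀ b → Division a b m
    divide []      = division [] [] DegBelow-[] (≋-sym (≋-trans (+P-identityʳ (a *P [])) (*P-zeroʳ a)))
    divide (x ∷ b) with divide b
    ... | division Q r r<m b≋aQ+r =
      division (lead ∷ Q) (scale (- lead) a +P (x ∷ r)) (degBelow remainder-vanish) (≋-sym x∷b≋)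
      where
      lead = coeff (x ∷ r) m
      remainder-vanish : ∀ i → m ℕ.≤ i → coeff (scale (- lead) a +P (x ∷ r)) i ≈ 0#
      remainder-vanish i m≤i with ℕ.m≤n⇒m<n∨m≡n m≤i
      ... | inj₁ m<i    = trans (coeff-+P (scale (- lead) a) (x ∷ r) i) (trans
        (+-cong (trans (coeff-scale (- lead) a i)
                       (trans (*-congˡ (vanish (proj₁ a-monic) i m<i)) (zeroʳ _)))
                (vanish (DegBelow-∷ r<m) i m<i))
        (+-identityˡ 0#))
      ... | inj₂ ≡.refl = trans (coeff-+P (scale (- lead) a) (x ∷ r) m) (trans
        (+-congʳ (trans (coeff-scale (- lead) a m) (trans (*-congˡ (proj₂ a-monic)) (*-identityʳ _))))
        (-‿inverseˡ lead))
      x∷b≋ : (a *P (lead ∷ Q)) +P (scale (- lead) a +P (x ∷ r)) ≋ x ∷ b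
      x∷b≋ = begin
        (a *P (lead ∷ Q)) +P (scale (- lead) a +P (x ∷ r))
          ≈⟨ +P-cong (*P-∷ʳ a lead Q) ≋-refl ⟩
        (scale lead a +P (T* (a *P Q))) +P (scale (- lead) a +P (x ∷ r))
          ≈⟨ +P-interchange (scale lead a) (T* (a *P Q)) (scale (- lead) a) (x ∷ r) ⟩
        (scale lead a +P scale (- lead) a) +P ((T* (a *P Q)) +P (x ∷ r))
          ≈⟨ +P-cong (≋-trans (≋-sym (scale-distribʳ lead (- lead) a))
                       (≋-trans (scale-cong (-‿inverseʳ lead) ≋-refl) (scale-zeroˡ a))) ≋-refl ⟩
        (T* (a *P Q)) +P (x ∷ r)
          ≈⟨ mk≋ (λ { zero → +-identityˡ x ; (suc i) → sym (coeff-≈ b≋aQ+r i) }) ⟩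
        x ∷ b ∎
        where open ≋-Reasoning

    ∣? : ∀ b → Dec (a ∣ b)
    ∣? b with divide b
    ... | division Q r r<m b≋aQ+r with ≋[]⊎HasDegree r
    ...   | inj₁ r≋0         = yes (xy≈z⇒x∣z a Q (≋-sym (≋+P[] b≋aQ+r r≋0)))
    ...   | inj₂ (_ , r-deg) = no λ a∣b → HasDegree⇒≉[] r-deg
      (∣∧DegBelow⇒≋[] (IsMonic⇒HasDegree a-monic) (∣-+P-cancelˡ (x∣xy a Q) (∣ʳ-respʳ-≈ b≋aQ+r a∣b)) r<m)

  monic-∣? : ∀ M p → Dec (toPol M ∣ p)
  monic-∣? M = ∣? (toPol-isMonic M)

  -- Irreducible polynomials

  unit-*P-cancelˡ : ∀ {a u b} → u ∣ 1P → a ∣ u *P b → a ∣ b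
  unit-*P-cancelˡ {u = u} {b} (w , wu≋1) a∣ub = ∣ʳ-respʳ-≈ wub≋b (x∣ʳy⇒x∣ʳzy w a∣ub)
    where
    wub≋b : w *P (u *P b) ≋ b
    wub≋b = ≋-trans (≋-sym (*P-assoc w u b)) (≋-trans (*P-congˡ b wu≋1) (*P-identityˡ b))

  irreducible-split : ∀ {p} → Irreducible p → ∀ a b → a *P b ≋ p → a ∣ 1P ⊎ b ∣ 1P
  irreducible-split (_ , _ , split) a b ab≋p with split a b (coeff-≈ ab≋p)
  ... | inj₁ a-unit = inj₁ (∣P⇒∣ a-unit)
  ... | inj₂ b-unit = inj₂ (∣P⇒∣ b-unit)

  irreducible-nonunit : ∀ {p} → Irreducible p → ¬ p ∣ 1P
  irreducible-nonunit (_ , p-nonunit , _) p∣1 = p-nonunit (∣⇒∣P p∣1)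

  irreducible⇒deg≥1 : ∀ M → Irreducible (toPol M) → 1 ℕ.≤ deg M
  irreducible⇒deg≥1 (monic zero [])  (_ , nonunit , _) =
    ⊥-elim (nonunit (1P , coeff-≈ (*P-identityʳ 1P)))
  irreducible⇒deg≥1 (monic (suc n) v) _ = s≤s z≤n

  irreducible-∤-smaller : ∀ {p a m n} → Irreducible p → HasDegree p n →
                          HasDegree a (suc m) → suc m ℕ.< n → ¬ a ∣ p
  irreducible-∤-smaller {p} {a} p-irr p-deg a-deg m<n (Q , Qa≋p)
    with irreducible-split p-irr a Q (≋-trans (*P-comm a Q) Qa≋p)
  ... | inj₁ a∣1 = ℕ.0≢1+n (HasDegree-unique (∣1P⇒HasDegree0 a∣1) a-deg)
  ... | inj₂ Q∣1 = HasDegree⇒≉[] a-deg (∣∧DegBelow⇒≋[] p-deg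
    (unit-*P-cancelˡ Q∣1 (∣ʳ-respʳ-≈ (≋-sym Qa≋p) ∣ʳ-refl)) (DegBelow-mono m<n (proj₁ a-deg)))

  irreducible-∣⇒∣ : ∀ {p p′} → Irreducible p → Irreducible p′ → p ∣ p′ → p′ ∣ p
  irreducible-∣⇒∣ {p} {p′} p-irr p′-irr (Q , Qp≋p′)
    with irreducible-split p′-irr p Q (≋-trans (*P-comm p Q) Qp≋p′)
  ... | inj₁ p∣1 = ⊥-elim (irreducible-nonunit p-irr p∣1)
  ... | inj₂ Q∣1 = unit-*P-cancelˡ Q∣1 (∣ʳ-respʳ-≈ (≋-sym Qp≋p′) ∣ʳ-refl)

  ∣-remainder : ∀ {p x b r} y Q → x ≋ (y *P Q) +P r → p ∣ y *P b → p ∣ x *P b → p ∣ r *P b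
  ∣-remainder {x = x} {b} {r} y Q x≋yQ+r p∣yb p∣xb =
    ∣-+P-cancelˡ (x∣ʳy⇒x∣ʳzy Q p∣yb) (∣ʳ-respʳ-≈ xb≋ p∣xb)
    where
    xb≋ : x *P b ≋ (Q *P (y *P b)) +P (r *P b)
    xb≋ = ≋-trans (*P-congˡ b x≋yQ+r) (≋-trans (*P-distribʳ b (y *P Q) r) (+P-cong
      (≋-trans (*P-congˡ b (*P-comm y Q)) (*P-assoc Q y b)) ≋-refl))

  ∏P : List Pol → Pol
  ∏P = List.foldr _*P_ 1P

  module Euclid {p n} (p-monic : IsMonic p (suc n)) (p-irr : Irreducible p) where

    p-deg : HasDegree p (suc n)
    p-deg = IsMonic⇒HasDegree p-monic

    reduce : ∀ {a j b} → IsMonic a (suc j) → suc j ℕ.< suc n → p ∣ a *P b →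
             ∃ λ r → DegBelow (suc j) r × ¬ r ≋ [] × p ∣ r *P b
    reduce {a} a-monic j<n p∣ab with divide a-monic p
    ... | division Q r r<j+1 p≋aQ+r with ≋[]⊎HasDegree r
    ...   | inj₁ r≋0         = ⊥-elim (irreducible-∤-smaller p-irr p-deg (IsMonic⇒HasDegree a-monic) j<n
                                 (xy≈z⇒x∣z a Q (≋-sym (≋+P[] p≋aQ+r r≋0))))
    ...   | inj₂ (_ , r-deg) =
      r , r<j+1 , HasDegree⇒≉[] r-deg , ∣-remainder a Q p≋aQ+r p∣ab (x∣xy p _)

    -- Descent on deg a: dividing p by the monic normalisation of a leaves, p being irreducible,
    -- a nonzero remainder r of smaller degree with p ∣ r·b.
    ∣-*P-cancelˡ : ∀ k {a b} → DegBelow k a → DegBelow (suc n) a → ¬ a ≋ [] →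
                   p ∣ a *P b → p ∣ b
    ∣-*P-cancelˡ zero    a<0   _     a≉0 _    = ⊥-elim (a≉0 (DegBelow-0⇒≋[] a<0))
    ∣-*P-cancelˡ (suc k) {a} {b} a<k+1 a<n+1 a≉0 p∣ab with ≋[]⊎HasDegree a
    ... | inj₁ a≋0             = ⊥-elim (a≉0 a≋0)
    ... | inj₂ (zero  , a-deg) = unit-*P-cancelˡ (HasDegree0⇒∣1P a-deg) p∣ab
    ... | inj₂ (suc j , a-deg) with reduce (normalise a-deg) j<n
                                      (∣ʳ-respʳ-≈ (scale-*Pˡ _ a b) (∣-scale _ p∣ab))
      where j<n = HasDegree∧DegBelow⇒< a-deg a<n+1
    ...   | r , r<j+1 , r≉0 , p∣rb = ∣-*P-cancelˡ k
      (DegBelow-mono (ℕ.≤-pred (HasDegree∧DegBelow⇒< a-deg a<k+1)) r<j+1)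
      (DegBelow-mono (ℕ.<⇒≤ (HasDegree∧DegBelow⇒< a-deg a<n+1)) r<j+1) r≉0 p∣rb

    euclid : ∀ {a b} → p ∣ a *P b → p ∣ a ⊎ p ∣ b
    euclid {a} {b} p∣ab with divide p-monic a
    ... | division Q r r<n+1 a≋pQ+r with ≋[]⊎HasDegree r
    ...   | inj₁ r≋0         = inj₁ (xy≈z⇒x∣z p Q (≋-sym (≋+P[] a≋pQ+r r≋0)))
    ...   | inj₂ (_ , r-deg) = inj₂ (∣-*P-cancelˡ (suc n) r<n+1 r<n+1 (HasDegree⇒≉[] r-deg)
                                       (∣-remainder p Q a≋pQ+r (x∣xy p _) p∣ab))

    ∣∏P⇒∣-some : ∀ as → p ∣ ∏P as → Any (p ∣_) as
    ∣∏P⇒∣-some []       p∣1  = ⊥-elim (irreducible-nonunit p-irr p∣1)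
    ∣∏P⇒∣-some (a ∷ as) p∣a∏ with euclid p∣a∏
    ... | inj₁ p∣a  = here p∣a
    ... | inj₂ p∣∏  = there (∣∏P⇒∣-some as p∣∏)

  monic-euclid : ∀ P → Irreducible (toPol P) → ∀ as → toPol P ∣ ∏P as → Any (toPol P ∣_) as
  monic-euclid P P-irr with irreducible⇒deg≥1 P P-irr
  monic-euclid P@(monic (suc n) v) P-irr | s≤s z≤n = Euclid.∣∏P⇒∣-some (toPol-isMonic P) P-irr

  irreducible-if-no-proper-monic-divisor : ∀ {p n} → IsMonic p (suc n) →
    (∀ {a j} → IsMonic a (suc j) → j ℕ.< n → ¬ a ∣ p) → Irreducible p
  irreducible-if-no-proper-monic-divisor {p} {n} p-monic no-divisor =
    (λ p≈0 → HasDegree⇒≉[] p-deg (mk≋ p≈0)) ,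
    (λ p-unit → ℕ.0≢1+n (HasDegree-unique (∣1P⇒HasDegree0 (∣P⇒∣ p-unit)) p-deg)) ,
    split
    where
    p-deg = IsMonic⇒HasDegree p-monic
    split : ∀ a b → (a *P b) ≈P p → IsUnit a ⊎ IsUnit b
    split a b ab≈p with ≋[]⊎HasDegree a | ≋[]⊎HasDegree b
    ... | inj₁ a≋0 | _ =
      ⊥-elim (HasDegree⇒≉[] p-deg (≋-trans (≋-sym (mk≋ ab≈p)) (*P-zeroˡ b a≋0)))
    ... | inj₂ _ | inj₁ b≋0 =
      ⊥-elim (HasDegree⇒≉[] p-deg
        (≋-trans (≋-sym (mk≋ ab≈p)) (≋-trans (*P-congʳ a b≋0) (*P-zeroʳ a))))
    ... | inj₂ (zero , a-deg) | inj₂ _ = inj₁ (∣⇒∣P (HasDegree0⇒∣1P a-deg))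
    ... | inj₂ (suc i , a-deg) | inj₂ (zero , b-deg) = inj₂ (∣⇒∣P (HasDegree0⇒∣1P b-deg))
    ... | inj₂ (suc i , a-deg) | inj₂ (suc k , b-deg) = ⊥-elim (no-divisor (normalise a-deg) i<n a′∣p)
      where
      i+k+2≡n+1 : suc i ℕ.+ suc k ≡ suc n
      i+k+2≡n+1 = HasDegree-unique (HasDegree-resp-≋ (mk≋ ab≈p) (HasDegree-*P a-deg b-deg)) p-deg
      i<n : i ℕ.< n
      i<n = ℕ.≤-trans (ℕ.m<m+n i (s≤s z≤n)) (ℕ.≤-reflexive (ℕ.suc-injective i+k+2≡n+1))
      a′∣p = ∣ʳ-trans (normalise-∣ a-deg) (xy≈z⇒x∣z a b (mk≋ ab≈p))

  irreducible-factor : ∀ M → 1 ℕ.≤ deg M →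
                       Σ Monic λ P → Irreducible (toPol P) × toPol P ∣ toPol M
  irreducible-factor M = go M (ℕ.<-wellFounded (deg M))
    where
    go : ∀ M → Acc ℕ._<_ (deg M) → 1 ℕ.≤ deg M →
         Σ Monic λ P → Irreducible (toPol P) × toPol P ∣ toPol M
    go M@(monic (suc n) v) (acc smaller) _
      with ℕ.anyUpTo? (λ j → any? (λ w → monic-∣? (monicOf w) (toPol M)) (allVecs q (suc j))) n
    ... | yes (j , j<n , divisor) with satisfied divisor
    ...   | w , w∣M with go (monicOf w) (smaller (s≤s j<n)) (s≤s z≤n)
    ...     | P , P-irr , P∣w = P , P-irr , ∣ʳ-trans P∣w w∣M
    go M@(monic (suc n) v) (acc smaller) _ | no no-divisor =
      M , irreducible-if-no-proper-monic-divisor (toPol-isMonic M) not-divisor , ∣ʳ-refl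
      where
      not-divisor : ∀ {a j} → IsMonic a (suc j) → j ℕ.< n → ¬ a ∣ toPol M
      not-divisor {a} {j} a-monic j<n a∣M with encode (suc j) a-monic
      ... | w , w≋a = no-divisor (j , j<n , lose (∈-allVecs w) (∣ʳ-respˡ-≈ (≋-sym w≋a) a∣M))

  record Factorisation (M : Monic) : Set (c ⊔ ℓ) where
    constructor mkFactorisation
    field
      factors             : List Monic
      factors-irreducible : All (Irreducible ∘ toPol) factors
      M≋∏factors          : toPol M ≋ ∏P (List.map toPol factors)
      #factors≤deg        : List.length factors ℕ.≤ deg M

  factorisation : ∀ M → Factorisation M
  factorisation M = go M (ℕ.<-wellFounded (deg M))
    where
    quotient-deg< : ∀ {k P m} → Irreducible (toPol P) → k ℕ.+ deg P ≡ m → k ℕ.< m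
    quotient-deg< {k} {P} P-irr k+degP≡m =
      ℕ.≤-trans (ℕ.m<m+n k (irreducible⇒deg≥1 P P-irr)) (ℕ.≤-reflexive k+degP≡m)

    go : ∀ M → Acc ℕ._<_ (deg M) → Factorisation M
    go (monic zero []) _ = mkFactorisation [] [] ≋-refl z≤n
    go M@(monic (suc n) v) (acc smaller) with irreducible-factor M (s≤s z≤n)
    ... | P , P-irr , (Q , QP≋M) with IsMonic-quotient (toPol-isMonic P) (toPol-isMonic M) QP≋M
    ...   | k , Q-monic , k+degP≡degM with encode k Q-monic
    ...     | w , w≋Q with go (monicOf w) (smaller (quotient-deg< {P = P} P-irr k+degP≡degM))
    ...       | mkFactorisation Ps Ps-irr w≋∏Ps #Ps≤k =
      mkFactorisation (P ∷ Ps) (P-irr ∷ Ps-irr) M≋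
                      (ℕ.≤-trans (s≤s #Ps≤k) (quotient-deg< {P = P} P-irr k+degP≡degM))
      where
      M≋ : toPol M ≋ toPol P *P ∏P (List.map toPol Ps)
      M≋ = ≋-trans (≋-sym QP≋M)
             (≋-trans (*P-comm Q (toPol P)) (*P-congʳ (toPol P) (≋-trans (≋-sym w≋Q) w≋∏Ps)))

  ∣∏P : ∀ Ps → All (λ P → toPol P ∣ ∏P (List.map toPol Ps)) Ps
  ∣∏P []       = []
  ∣∏P (P ∷ Ps) = x∣xy (toPol P) _ ∷ All.map (x∣ʳy⇒x∣ʳzy (toPol P)) (∣∏P Ps)

  -- Counting multiples

  monicOf-++-difference : ∀ {m n} (a a′ : Vec (Fin q) m) (b : Vec (Fin q) n) →
    DegBelow m (toPol (monicOf (a Vec.++ b)) +P (-P toPol (monicOf (a′ Vec.++ b))))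
  monicOf-++-difference {m} a a′ b = degBelow λ i m≤i → vanish-at (ℕ.m≤n⇒∃[o]m+o≡n m≤i)
    where
    f = toPol (monicOf (a Vec.++ b))
    f′ = toPol (monicOf (a′ Vec.++ b))
    vanish-at : ∀ {i} → ∃ (λ j → m ℕ.+ j ≡ i) → coeff (f +P (-P f′)) i ≈ 0#
    vanish-at (j , ≡.refl) = trans (coeff-+P f (-P f′) (m ℕ.+ j)) (trans
      (+-cong (reflexive (coeff-monicOf-++ a b j))
              (trans (coeff-P f′ (m ℕ.+ j)) (-‿cong (reflexive (coeff-monicOf-++ a′ b j)))))
      (-‿inverseʳ _))

  -- In monicOf (a ++ b) the prefix a holds the coefficients of T⁰, …, T^(deg M − 1), so two
  -- multiples of M sharing b differ by a multiple of M of degree < deg M.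
  monic-multiple-prefix-unique : ∀ M {n} {a a′ : Vec (Fin q) (deg M)} (b : Vec (Fin q) n) →
    toPol M ∣ toPol (monicOf (a Vec.++ b)) → toPol M ∣ toPol (monicOf (a′ Vec.++ b)) → a ≡ a′
  monic-multiple-prefix-unique M {a = a} {a′} b M∣f M∣f′ = Vec.++-injectiveˡ a a′ (monicOf-injective
    (x∙y⁻¹≈ε⇒x≈y _ _ (∣∧DegBelow⇒≋[] (toPol-hasDegree M) (∣-+P M∣f (∣-scale (- 1#) M∣f′))
                                     (monicOf-++-difference a a′ b))))

  𝟙[_∣_] : Monic → ∀ {d} → Vec (Fin q) d → ℕ
  𝟙[ M ∣ v ] = 𝟙 (monic-∣? M (toPol (monicOf v)))

  count-multiples : ∀ M d → (∑[ v ∈ allVecs q d ] 𝟙[ M ∣ v ]) ℕ.* q ℕ.^ deg M ℕ.≤ q ℕ.^ d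
  count-multiples M d with deg M ℕ.≤? d
  ... | yes m≤d with ℕ.m≤n⇒∃[o]m+o≡n m≤d
  ...   | n , ≡.refl = ∑-allVecs-𝟙-prefix-unique (deg M) n (λ v → monic-∣? M (toPol (monicOf v)))
                         (monic-multiple-prefix-unique M)
  count-multiples M d | no m≰d = ℕ.≤-trans (ℕ.*-monoˡ-≤ (q ℕ.^ deg M) no-multiples) z≤n
    where
    no-multiple : ∀ v → 𝟙[ M ∣ v ] ℕ.≤ 0
    no-multiple v with monic-∣? M (toPol (monicOf v))
    ... | yes M∣v = ⊥-elim (m≰d (∣⇒deg≤ (toPol-hasDegree M) (toPol-hasDegree (monicOf v)) M∣v))
    ... | no  _   = z≤n
    no-multiples : ∑[ v ∈ allVecs q d ] 𝟙[ M ∣ v ] ℕ.≤ 0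
    no-multiples =
      ℕ.≤-trans (∑-mono-≤ (allVecs q d) no-multiple) (ℕ.≤-reflexive (∑-zero (allVecs q d)))

  count-multiples-deg≥ : ∀ {k} M d → k ℕ.≤ deg M →
                         (∑[ v ∈ allVecs q d ] 𝟙[ M ∣ v ]) ℕ.* q ℕ.^ k ℕ.≤ q ℕ.^ d
  count-multiples-deg≥ M d k≤m = ℕ.≤-trans
    (ℕ.*-monoʳ-≤ (∑[ v ∈ allVecs q d ] 𝟙[ M ∣ v ])
                 (ℕ.^-monoʳ-≤ q {{nonZeroIndex (enum⁻¹ 0#)}} k≤m))
    (count-multiples M d)

  deg-common-divisor≤ : ∀ {Ps} → All (Irreducible ∘ toPol) Ps → ∀ {d} (v : Vec (Fin q) d) h →
    toPol h ∣ ∏P (List.map toPol Ps) → toPol h ∣ toPol (monicOf v) →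
    deg h ℕ.≤ d ℕ.* ∑[ P ∈ Ps ] 𝟙[ P ∣ v ]
  deg-common-divisor≤ Ps-irr v (monic zero _) _ _ = z≤n
  deg-common-divisor≤ {Ps} Ps-irr {d} v h@(monic (suc n) _) h∣∏ h∣f
    with irreducible-factor h (s≤s z≤n)
  ... | P₀ , P₀-irr , P₀∣h = begin
    deg h                        ≤⟨ ∣⇒deg≤ (toPol-hasDegree h) (toPol-hasDegree (monicOf v)) h∣f ⟩
    d                            ≡⟨ ℕ.*-identityʳ d ⟨
    d ℕ.* 1                      ≤⟨ ℕ.*-monoʳ-≤ d (∑-𝟙-Any (λ P → monic-∣? P f) (Ps-∣f Ps-irr P₀∣Ps)) ⟩
    d ℕ.* ∑[ P ∈ Ps ] 𝟙[ P ∣ v ] ∎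
    where
    open ℕ.≤-Reasoning
    f = toPol (monicOf v)
    P₀∣Ps : Any (λ P → toPol P₀ ∣ toPol P) Ps
    P₀∣Ps = AnyP.map⁻ (monic-euclid P₀ P₀-irr (List.map toPol Ps) (∣ʳ-trans P₀∣h h∣∏))
    Ps-∣f : ∀ {Ps} → All (Irreducible ∘ toPol) Ps →
            Any (λ P → toPol P₀ ∣ toPol P) Ps → Any (λ P → toPol P ∣ f) Ps
    Ps-∣f (P-irr ∷ _)  (here P₀∣P) =
      here (∣ʳ-trans (irreducible-∣⇒∣ P₀-irr P-irr P₀∣P) (∣ʳ-trans P₀∣h h∣f))
    Ps-∣f (_ ∷ Ps-irr) (there i)   = there (Ps-∣f Ps-irr i)

open import Data.Nat using (_*_; _^_; _<_; _≤_)
open import Data.Nat.Properties using (*-assoc; *-monoˡ-≤; *-monoʳ-≤)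

lemma4p6 : ∀ {c ℓ : Level} (q : ℕ) → IsPrimePower q → (F : FiniteField c ℓ q) →
  let open Poly F in
  (e d : ℕ) → 0 < d → d < e →
  (g : Monic) → deg g ≡ e →
  (k : ℕ) →
  (Σ Monic λ p → Irreducible (toPol p) × (toPol p ∣P toPol g) × (deg p ≡ k)) →
  (∀ (p : Monic) → Irreducible (toPol p) → toPol p ∣P toPol g → k ≤ deg p) →
  (G : Vec (Fin q) d → Monic) →
  (∀ v → IsGCD (toPol g) (toPol (monicOf v)) (G v)) →
  sumVecs q d (λ v → deg (G v)) * q ^ k ≤ d * e * q ^ d
lemma4p6 q _ F e d _ _ g ≡.refl k _ k-minimal G G-gcd = begin
  sumVecs q d (λ v → deg (G v)) * q ^ k
    ≤⟨ *-monoˡ-≤ (q ^ k) (∑-mono-≤ (allVecs q d) deg-G≤) ⟩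
  (∑[ v ∈ allVecs q d ] (d * ∑[ P ∈ Ps ] 𝟙[ P ∣ v ])) * q ^ k
    ≡⟨ ≡.cong (_* q ^ k) (≡.trans (∑-*ˡ (allVecs q d) d _)
                                  (≡.cong (d *_) (∑-comm (allVecs q d) Ps _))) ⟩
  d * (∑[ P ∈ Ps ] ∑[ v ∈ allVecs q d ] 𝟙[ P ∣ v ]) * q ^ k
    ≡⟨ ≡.trans (*-assoc d _ (q ^ k)) (≡.cong (d *_) (≡.sym (∑-*ʳ Ps (q ^ k) _))) ⟩
  d * ∑[ P ∈ Ps ] ((∑[ v ∈ allVecs q d ] 𝟙[ P ∣ v ]) * q ^ k)
    ≤⟨ *-monoʳ-≤ d (∑-bounded (All.zipWith count-P (Ps-irr , ∣∏P Ps))) ⟩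
  d * (List.length Ps * q ^ d)
    ≤⟨ *-monoʳ-≤ d (*-monoˡ-≤ (q ^ d) #Ps≤deg) ⟩
  d * (deg g * q ^ d)
    ≡⟨ *-assoc d (deg g) (q ^ d) ⟨
  d * deg g * q ^ d ∎
  where
  open ℕ.≤-Reasoning
  open Poly F
  open PolyProperties F
  open Factorisation (factorisation g)
    renaming ( factors to Ps ; factors-irreducible to Ps-irr
             ; M≋∏factors to g≋∏Ps ; #factors≤deg to #Ps≤deg )
  deg-G≤ : ∀ v → deg (G v) ≤ d * ∑[ P ∈ Ps ] 𝟙[ P ∣ v ]
  deg-G≤ v = deg-common-divisor≤ Ps-irr v (G v)
    (∣ʳ-respʳ-≈ g≋∏Ps (∣P⇒∣ (proj₁ (G-gcd v)))) (∣P⇒∣ (proj₁ (proj₂ (G-gcd v))))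
  count-P : ∀ {P} → Irreducible (toPol P) × toPol P ∣ ∏P (List.map toPol Ps) →
            (∑[ v ∈ allVecs q d ] 𝟙[ P ∣ v ]) * q ^ k ≤ q ^ d
  count-P {P} (P-irr , P∣∏) =
    count-multiples-deg≥ P d (k-minimal P P-irr (∣⇒∣P (∣ʳ-respʳ-≈ (≋-sym g≋∏Ps) P∣∏)))
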